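{- Let $r\ge 2$ be an integer with $\gcd(r,3)=1$. Then $r$ is distinguished with respect to $(3,1)$ if and only if $\operatorname{ord}_r(3)=\operatorname{ord}_{2r}(3)$.
   Context: For integers $s$ and $r\ge 1$ with $\gcd(r,s)=1$, $\operatorname{ord}_r(s)$ denotes the multiplicative order of $s$ modulo $r$, i.e. the least positive integer $m$ with $s^m\equiv 1\pmod r$. An integer $r\ge 2$ is distinguished with respect to $(3,1)$ if $\gcd(r,3)=1$ and $r$ divides $\frac{3^{\operatorname{ord}_r(3)}-1}{3-1}$. -}

module Defs where

open import Data.Nat using (ℕ; _^_; _∸_; _≤_; _<_; _≥_; _*_)
open import Data.Nat.Divisibility using (_∣_)
open import Data.Nat.GCD using (gcd)
open import Data.Nat.DivMod using (_/_)
open import Data.Product using (_×_; ∃-syntax)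
open import Relation.Binary.PropositionalEquality using (_≡_)
open import Relation.Nullary using (¬_)

-- s^m ≡ 1 (mod r), written as divisibility  r ∣ s^m - 1  (s^m ≥ 1 for s ≥ 1)
_≡1-mod_ : ℕ → ℕ → Set
a ≡1-mod r = r ∣ (a ∸ 1)

IsOrd : ℕ → ℕ → ℕ → Set
IsOrd r s m = (1 ≤ m) × ((s ^ m) ≡1-mod r)
              × (∀ k → 1 ≤ k → k < m → ¬ ((s ^ k) ≡1-mod r))

Distinguished31 : ℕ → Set
Distinguished31 r = (2 ≤ r) × (gcd r 3 ≡ 1)
                    × ∃[ m ] (IsOrd r 3 m × (r ∣ ((3 ^ m ∸ 1) / 2)))

{-# OPTIONS --safe #-}
module Submission where

-- Since 3ⁿ − 1 is always even, r ∣ (3ⁿ − 1)/2 is the same as 2r ∣ 3ⁿ − 1.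
-- So r is distinguished exactly when 3^(ord_r 3) ≡ 1 (mod 2r), i.e. when
-- ord_{2r} 3 ≤ ord_r 3; the reverse inequality always holds because r ∣ 2r.

open import Defs
open import Data.Nat using (ℕ; suc; zero; _≤_; _*_; _^_; _∸_; _/_)
open import Data.Nat.Properties using (≤-antisym; <⇒≤; ≤-reflexive; <-cmp; m^n>0)
open import Data.Nat.Divisibility
  using (_∣_; ∣-trans; n∣m*n; m∣m*n; ∣m∣n⇒∣m+n; m∣n/o⇒o*m∣n; m*n∣o⇒n∣o/m; _∣0)
open import Data.Nat.GCD using (gcd)
open import Data.Product using (_,_; proj₁; proj₂)
open import Data.Empty using (⊥-elim)
open import Relation.Binary.Definitions using (tri<; tri≈; tri>)
open import Relation.Binary.PropositionalEquality using (_≡_; refl; subst; sym)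
open import Function.Bundles using (_⇔_; mk⇔)

m∸1∣m^n∸1 : ∀ m n → m ∸ 1 ∣ m ^ n ∸ 1
m∸1∣m^n∸1 zero    zero    = 0 ∣0
m∸1∣m^n∸1 zero    (suc n) = 0 ∣0
m∸1∣m^n∸1 (suc m) zero    = m ∣0
-- With (m+1)ⁿ = p+1, (m+1)ⁿ⁺¹ ∸ 1 reduces to p + m(p+1); positivity rules out (m+1)ⁿ = 0.
m∸1∣m^n∸1 (suc m) (suc n) with suc m ^ n | m^n>0 (suc m) n | m∸1∣m^n∸1 (suc m) n
... | suc p | _ | m∣p = ∣m∣n⇒∣m+n m∣p (m∣m*n (suc p))

IsOrd-minimal : ∀ {r s m k} → IsOrd r s m → 1 ≤ k → (s ^ k) ≡1-mod r → m ≤ k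
IsOrd-minimal {m = m} {k} (_ , _ , below-m) 1≤k sᵏ≡1 with <-cmp m k
... | tri< m<k _ _ = <⇒≤ m<k
... | tri≈ _ m≡k _ = ≤-reflexive m≡k
... | tri> _ _ k<m = ⊥-elim (below-m k 1≤k k<m sᵏ≡1)

IsOrd-unique : ∀ {r s m m′} → IsOrd r s m → IsOrd r s m′ → m ≡ m′
IsOrd-unique ord@(1≤m , sᵐ≡1 , _) ord′@(1≤m′ , sᵐ′≡1 , _) =
  ≤-antisym (IsOrd-minimal ord 1≤m′ sᵐ′≡1) (IsOrd-minimal ord′ 1≤m sᵐ≡1)

IsOrd-mono-∣ : ∀ {r n s m m′} → r ∣ n → IsOrd r s m → IsOrd n s m′ → m ≤ m′
IsOrd-mono-∣ r∣n ord (1≤m′ , sᵐ′≡1 , _) = IsOrd-minimal ord 1≤m′ (∣-trans r∣n sᵐ′≡1)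

lemma2p2 : (r : ℕ) → 2 ≤ r → gcd r 3 ≡ 1 →
           (m m′ : ℕ) → IsOrd r 3 m → IsOrd (2 * r) 3 m′ →
           (Distinguished31 r ⇔ (m ≡ m′))
lemma2p2 r 2≤r coprime m m′ ord ord′ = mk⇔ to from
  where
  to : Distinguished31 r → m ≡ m′
  to (_ , _ , k , ordₖ , r∣half) = ≤-antisym
    (IsOrd-mono-∣ (n∣m*n 2) ord ord′)
    (IsOrd-minimal ord′ (proj₁ ord) (m∣n/o⇒o*m∣n (m∸1∣m^n∸1 3 m) r∣halfₘ))
    where
    r∣halfₘ : r ∣ (3 ^ m ∸ 1) / 2
    r∣halfₘ = subst (λ j → r ∣ (3 ^ j ∸ 1) / 2) (sym (IsOrd-unique ord ordₖ)) r∣half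

  from : m ≡ m′ → Distinguished31 r
  from refl = 2≤r , coprime , m , ord , m*n∣o⇒n∣o/m 2 r (proj₁ (proj₂ ord′))
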